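{- In the setting described in the context (with $U_0$ a recurrent state and $v_1$ following an anti-threshold rule), let $x\in\{+1,-1\}$ and $t\ge0$. If $(c_t,c_{t+1},c_{t+2},c_{t+3},c_{t+4})=(x,-x,x,x,-x)$, then $v_1$ has a loop.
   Context: $G$ is a finite graph (loops allowed, no multiple edges) on vertex set $\{v_1,\dots,v_n\}$; $N_i$ is the neighbourhood of $v_i$ (including $v_i$ iff there is a loop at $v_i$). Each vertex holds an opinion in $\{+1,-1\}$; $U_t$ is the set of vertices with opinion $+1$ at time $t$. All vertices update simultaneously: $v_i\in U_{t+1}$ iff $N_i\cap U_t\in\mathcal S_i$, where for $i\ge2$, $\mathcal S_i=\{A\subseteq N_i:|A|\ge r_i\}$ (threshold rule, integer $r_i$), and $v_1$ follows an anti-threshold rule: $\mathcal S_1=\{A\subseteq N_1:|A|<r_1\}$ for some integer $r_1$. The initial state is recurrent: $U_p=U_0$ for some $p\ge1$. $c_t\in\{+1,-1\}$ denotes the opinion of $v_1$ at time $t$. -}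

module Defs where

open import Data.Nat using (ℕ; zero; suc; _+_)
open import Data.Integer using (ℤ; +_) renaming (_≤_ to _≤ℤ_; _<_ to _<ℤ_)
open import Data.Integer.Properties using () renaming (_≤?_ to _≤ℤ?_; _<?_ to _<ℤ?_)
open import Data.Bool using (Bool; true; false; _∧_; not)
open import Data.Fin using (Fin; zero; suc)
open import Relation.Nullary.Decidable using (⌊_⌋)
open import Relation.Binary.PropositionalEquality using (_≡_)
open import Data.Product using (_×_)

-- A finite graph on vertices Fin m (vertex `zero` is v₁), loops allowed,
-- no multiple edges: a symmetric Bool-valued adjacency relation.
-- adj i i ≡ true means there is a loop at vertex i.
record Graph (m : ℕ) : Set where
  field
    adj : Fin m → Fin m → Bool
    sym : ∀ i j → adj i j ≡ adj j i
open Graph public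

-- A state: opinion of each vertex; true = +1, false = -1.
-- The set U of +1 vertices is { j | s j ≡ true }.
State : ℕ → Set
State m = Fin m → Bool

countTrue : ∀ {m} → (Fin m → Bool) → ℕ
countTrue {zero} f = 0
countTrue {suc m} f = (if' (f zero)) + countTrue (λ j → f (suc j))
  where
  if' : Bool → ℕ
  if' true = 1
  if' false = 0

nbrPlus : ∀ {m} → Graph m → State m → Fin m → ℕ
nbrPlus G s i = countTrue (λ j → adj G i j ∧ s j)

step : ∀ {n} → Graph (suc n) → (Fin (suc n) → ℤ) → State (suc n) → State (suc n)
step G r s zero    = ⌊ (+ nbrPlus G s zero) <ℤ? r zero ⌋
step G r s (suc i) = ⌊ r (suc i) ≤ℤ? (+ nbrPlus G s (suc i)) ⌋

run : ∀ {n} → Graph (suc n) → (Fin (suc n) → ℤ) → State (suc n) → ℕ → State (suc n)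
run G r s₀ zero    = s₀
run G r s₀ (suc t) = step G r (run G r s₀ t)

Recurrent : ∀ {n} → Graph (suc n) → (Fin (suc n) → ℤ) → State (suc n) → Set
Recurrent G r s₀ = Data.Product.∃ λ p → ∀ j → run G r s₀ (suc p) j ≡ s₀ j

c : ∀ {n} → Graph (suc n) → (Fin (suc n) → ℤ) → State (suc n) → ℕ → Bool
c G r s₀ t = run G r s₀ t zero

-- The vertices v₂ … vₙ form a symmetric threshold network driven by the opinion of v₁. Counting
-- v₁ as an input of weight ½ in the thresholds of its neighbours, the Goles–Olivos energy of two
-- consecutive states never decreases, and it increases strictly as soon as some vertex i ≠ v₁
-- has different opinions at times s and s + 2 and its opinion at time s + 2 differs from c_{s+1}.
-- A recurrent trajectory is periodic, so its energy is constant: when c_{t+1} = −x, every vertex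
-- i ≠ v₁ with opinion x at time t + 2 already had opinion x at time t. Threshold rules are
-- monotone, so every neighbour of v₁ with opinion x at time t + 3 had opinion x at time t + 1; if
-- v₁ had no loop, its antitone rule would turn c_{t+4} = −x into c_{t+2} = −x.

module Submission where

open import Defs hiding (sym)
open import Data.Nat using (ℕ; zero; suc; _+_; _≤_; z≤n; s≤s)
import Data.Nat.Properties as ℕ
open import Data.Integer
  using (ℤ; +_; 0ℤ; 1ℤ; +≤+; +<+; -_)
  renaming (_+_ to _+ℤ_; _-_ to _-ℤ_; _*_ to _*ℤ_; _≤_ to _≤ℤ_; _<_ to _<ℤ_)
open import Data.Integer.Properties
  using (≤-refl; ≤-trans; <-irrefl; ≤-<-trans; +-mono-≤; +-mono-≤-<; +-mono-<-≤;
         +-monoʳ-≤; +-monoʳ-<; +-identityʳ; *-identityˡ; neg-distrib-+; pos-+;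
         i≤j⇒0≤j-i; i<j⇒suc[i]≤j; ≰⇒>; ≤-poset; +-*-semiring)
  renaming (_≤?_ to _≤ℤ?_; _<?_ to _<ℤ?_)
open import Data.Integer.Tactic.RingSolver using (solve-∀)
open import Data.Bool using (Bool; true; false; not; _∧_; _≟_)
open import Data.Bool.Properties using (not-¬; ¬-not)
open import Data.Fin using (Fin; zero; suc)
open import Data.Vec.Functional using (Vector)
open import Data.Product using (_×_; _,_; proj₁; proj₂; map₂)
open import Function using (_∘_; const)
open import Relation.Binary.Bundles using (Poset)
open import Relation.Nullary using (¬_; Dec; yes; no; contradiction)
open import Relation.Nullary.Decidable using (⌊_⌋)
open import Relation.Binary.PropositionalEquality
  using (_≡_; _≢_; _≗_; refl; sym; trans; cong; cong₂; subst; module ≡-Reasoning)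
open import Algebra.Properties.Semiring.Sum +-*-semiring
  using (sum; sum-syntax; sum-cong-≗; ∑-distrib-+; ∑-comm; *-distribˡ-sum)

⟦_⟧ : Bool → ℤ
⟦ true ⟧  = 1ℤ
⟦ false ⟧ = 0ℤ

⟦∧⟧ : ∀ a b → ⟦ a ∧ b ⟧ ≡ ⟦ a ⟧ *ℤ ⟦ b ⟧
⟦∧⟧ true  b = sym (*-identityˡ ⟦ b ⟧)
⟦∧⟧ false b = refl

not-contrapositive : ∀ x {a b : Bool} → (a ≡ x → b ≡ x) → b ≡ not x → a ≡ not x
not-contrapositive true  {false} _ _ = refl
not-contrapositive true  {true}  k e = sym (trans (sym e) (k refl))
not-contrapositive false {true}  _ _ = refl
not-contrapositive false {false} k e = sym (trans (sym e) (k refl))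

⌊⌋-mono : ∀ {A B : Set} (a? : Dec A) (b? : Dec B) → (A → B) → ⌊ a? ⌋ ≡ true → ⌊ b? ⌋ ≡ true
⌊⌋-mono (yes a) (yes b) f _ = refl
⌊⌋-mono (yes a) (no ¬b) f _ = contradiction (f a) ¬b

∧-keeps : ∀ a {b b′} → (a ≡ true → b ≡ true → b′ ≡ true) → a ∧ b ≡ true → a ∧ b′ ≡ true
∧-keeps true k = k refl

∑-neg : ∀ {m} (f : Vector ℤ m) → ∑[ i < m ] (- f i) ≡ - ∑[ i < m ] f i
∑-neg {zero}  f = refl
∑-neg {suc m} f = trans (cong (- f zero +ℤ_) (∑-neg (f ∘ suc))) (sym (neg-distrib-+ (f zero) _))

∑-distrib-- : ∀ {m} (f g : Vector ℤ m) → ∑[ i < m ] (f i -ℤ g i) ≡ ∑[ i < m ] f i -ℤ ∑[ i < m ] g i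
∑-distrib-- f g = trans (∑-distrib-+ f (-_ ∘ g)) (cong (sum f +ℤ_) (∑-neg g))

∑-nonneg : ∀ {m} (f : Vector ℤ m) → (∀ i → 0ℤ ≤ℤ f i) → 0ℤ ≤ℤ ∑[ i < m ] f i
∑-nonneg {zero}  f f≥0 = ≤-refl
∑-nonneg {suc m} f f≥0 = +-mono-≤ (f≥0 zero) (∑-nonneg (f ∘ suc) (f≥0 ∘ suc))

∑-pos : ∀ {m} (f : Vector ℤ m) → (∀ i → 0ℤ ≤ℤ f i) → ∀ k → 0ℤ <ℤ f k → 0ℤ <ℤ ∑[ i < m ] f i
∑-pos {suc m} f f≥0 zero    fk>0 = +-mono-<-≤ fk>0 (∑-nonneg (f ∘ suc) (f≥0 ∘ suc))
∑-pos {suc m} f f≥0 (suc k) fk>0 = +-mono-≤-< (f≥0 zero) (∑-pos (f ∘ suc) (f≥0 ∘ suc) k fk>0)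

0≤j⇒i≤i+j : ∀ {i j} → 0ℤ ≤ℤ j → i ≤ℤ i +ℤ j
0≤j⇒i≤i+j {i} 0≤j = subst (_≤ℤ i +ℤ _) (+-identityʳ i) (+-monoʳ-≤ i 0≤j)

0<j⇒i<i+j : ∀ {i j} → 0ℤ <ℤ j → i <ℤ i +ℤ j
0<j⇒i<i+j {i} 0<j = subst (_<ℤ i +ℤ _) (+-identityʳ i) (+-monoʳ-< i 0<j)

module _ {a ℓ₁ ℓ₂} (P : Poset a ℓ₁ ℓ₂) where
  private module P = Poset P

  nondecreasing-periodic⇒constant : ∀ (f : ℕ → P.Carrier) p →
    (∀ s → f s P.≤ f (suc s)) → (∀ s → f (s + suc p) P.≈ f s) → ∀ s → f (suc s) P.≈ f s
  nondecreasing-periodic⇒constant f p f-mono f-periodic s =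
    P.antisym (P.trans (iterate p (suc s)) (P.reflexive f-periodic′)) (f-mono s)
    where
    iterate : ∀ m s → f s P.≤ f (m + s)
    iterate zero    s = P.refl
    iterate (suc m) s = P.trans (iterate m s) (f-mono (m + s))
    f-periodic′ : f (p + suc s) P.≈ f s
    f-periodic′ = subst (λ k → f k P.≈ f s) (trans (ℕ.+-suc s p) (ℕ.+-comm (suc s) p)) (f-periodic s)

countTrue-∑ : ∀ {m} (f : Fin m → Bool) → + countTrue f ≡ ∑[ j < m ] ⟦ f j ⟧
countTrue-∑ {zero}  f = refl
countTrue-∑ {suc m} f with f zero
... | true  = trans (pos-+ 1 (countTrue (f ∘ suc))) (cong (1ℤ +ℤ_) (countTrue-∑ (f ∘ suc)))
... | false = trans (pos-+ 0 (countTrue (f ∘ suc))) (cong (0ℤ +ℤ_) (countTrue-∑ (f ∘ suc)))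

countTrue-mono : ∀ {m} {f g : Fin m → Bool} → (∀ j → f j ≡ true → g j ≡ true) →
                 countTrue f ≤ countTrue g
countTrue-mono {zero}          f⊆g = z≤n
countTrue-mono {suc m} {f} {g} f⊆g with f zero in f₀ | g zero in g₀
... | true  | true  = s≤s (countTrue-mono (f⊆g ∘ suc))
... | true  | false = contradiction (trans (sym (f⊆g zero f₀)) g₀) λ ()
... | false | true  = ℕ.m≤n⇒m≤1+n (countTrue-mono (f⊆g ∘ suc))
... | false | false = countTrue-mono (f⊆g ∘ suc)

module Energy {n : ℕ} (W : Fin n → Fin n → ℤ) (W-sym : ∀ i j → W i j ≡ W j i) (θ : Vector ℤ n) where

  input : Vector ℤ n → Fin n → ℤ
  input y i = ∑[ j < n ] (W i j *ℤ y j)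

  form : Vector ℤ n → Vector ℤ n → ℤ
  form x y = ∑[ i < n ] (x i *ℤ input y i)

  cost : Vector ℤ n → ℤ
  cost x = ∑[ i < n ] (x i *ℤ θ i)

  energy : Vector ℤ n → Vector ℤ n → ℤ
  energy x y = + 2 *ℤ form x y -ℤ cost x -ℤ cost y

  localField : Vector ℤ n → Fin n → ℤ
  localField y i = + 2 *ℤ input y i -ℤ θ i

  form-sym : ∀ x y → form x y ≡ form y x
  form-sym x y = begin
    ∑[ i < n ] (x i *ℤ input y i)
      ≡⟨ sum-cong-≗ (λ i → *-distribˡ-sum (x i) (λ j → W i j *ℤ y j)) ⟩
    ∑[ i < n ] ∑[ j < n ] (x i *ℤ (W i j *ℤ y j))
      ≡⟨ ∑-comm (λ i j → x i *ℤ (W i j *ℤ y j)) ⟩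
    ∑[ j < n ] ∑[ i < n ] (x i *ℤ (W i j *ℤ y j))
      ≡⟨ sum-cong-≗ (λ j → sum-cong-≗ (λ i → transpose i j)) ⟩
    ∑[ j < n ] ∑[ i < n ] (y j *ℤ (W j i *ℤ x i))
      ≡⟨ sum-cong-≗ (λ j → *-distribˡ-sum (y j) (λ i → W j i *ℤ x i)) ⟨
    ∑[ j < n ] (y j *ℤ input x j)
      ∎
    where
    open ≡-Reasoning
    commute : ∀ a b w → a *ℤ (w *ℤ b) ≡ b *ℤ (w *ℤ a)
    commute = solve-∀
    transpose : ∀ i j → x i *ℤ (W i j *ℤ y j) ≡ y j *ℤ (W j i *ℤ x i)
    transpose i j = trans (commute (x i) (y j) (W i j)) (cong (λ w → y j *ℤ (w *ℤ x i)) (W-sym i j))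

  energy-sym : ∀ x y → energy x y ≡ energy y x
  energy-sym x y = trans (cong (λ f → + 2 *ℤ f -ℤ cost x -ℤ cost y) (form-sym x y))
                         (rearrange (form y x) (cost x) (cost y))
    where
    rearrange : ∀ f a b → + 2 *ℤ f -ℤ a -ℤ b ≡ + 2 *ℤ f -ℤ b -ℤ a
    rearrange = solve-∀

  ∑-localField : ∀ x y → ∑[ i < n ] (x i *ℤ localField y i) ≡ + 2 *ℤ form x y -ℤ cost x
  ∑-localField x y = begin
    ∑[ i < n ] (x i *ℤ localField y i)
      ≡⟨ sum-cong-≗ (λ i → expand (x i) (input y i) (θ i)) ⟩
    ∑[ i < n ] (+ 2 *ℤ (x i *ℤ input y i) -ℤ x i *ℤ θ i)
      ≡⟨ ∑-distrib-- (λ i → + 2 *ℤ (x i *ℤ input y i)) (λ i → x i *ℤ θ i) ⟩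
    ∑[ i < n ] (+ 2 *ℤ (x i *ℤ input y i)) -ℤ cost x
      ≡⟨ cong (_-ℤ cost x) (*-distribˡ-sum (+ 2) (λ i → x i *ℤ input y i)) ⟨
    + 2 *ℤ form x y -ℤ cost x
      ∎
    where
    open ≡-Reasoning
    expand : ∀ a s t → a *ℤ (+ 2 *ℤ s -ℤ t) ≡ + 2 *ℤ (a *ℤ s) -ℤ a *ℤ t
    expand = solve-∀

  energy-step : ∀ x y z → energy z y ≡ energy y x +ℤ ∑[ i < n ] ((z i -ℤ x i) *ℤ localField y i)
  energy-step x y z = begin
    energy z y
      ≡⟨ regroup (form z y) (form x y) (cost x) (cost y) (cost z) ⟩
    energy x y +ℤ ((+ 2 *ℤ form z y -ℤ cost z) -ℤ (+ 2 *ℤ form x y -ℤ cost x))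
      ≡⟨ cong₂ _+ℤ_ (energy-sym y x) (cong₂ _-ℤ_ (∑-localField z y) (∑-localField x y)) ⟨
    energy y x +ℤ (∑[ i < n ] (z i *ℤ localField y i) -ℤ ∑[ i < n ] (x i *ℤ localField y i))
      ≡⟨ cong (energy y x +ℤ_) (∑-distrib-- (λ i → z i *ℤ localField y i) (λ i → x i *ℤ localField y i)) ⟨
    energy y x +ℤ ∑[ i < n ] (z i *ℤ localField y i -ℤ x i *ℤ localField y i)
      ≡⟨ cong (energy y x +ℤ_) (sum-cong-≗ (λ i → factor (z i) (x i) (localField y i))) ⟩
    energy y x +ℤ ∑[ i < n ] ((z i -ℤ x i) *ℤ localField y i)
      ∎
    where
    open ≡-Reasoning
    regroup : ∀ fz fx cx cy cz →
      + 2 *ℤ fz -ℤ cz -ℤ cy ≡ (+ 2 *ℤ fx -ℤ cx -ℤ cy) +ℤ ((+ 2 *ℤ fz -ℤ cz) -ℤ (+ 2 *ℤ fx -ℤ cx))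
    regroup = solve-∀
    factor : ∀ a b l → a *ℤ l -ℤ b *ℤ l ≡ (a -ℤ b) *ℤ l
    factor = solve-∀

  energy-cong : ∀ {x x′ y y′} → x ≗ x′ → y ≗ y′ → energy x y ≡ energy x′ y′
  energy-cong {x} {x′} {y} {y′} x≗x′ y≗y′ =
    cong₂ _-ℤ_ (cong₂ _-ℤ_ (cong (+ 2 *ℤ_) form≡) (cost-cong x≗x′)) (cost-cong y≗y′)
    where
    cost-cong : ∀ {u u′} → u ≗ u′ → cost u ≡ cost u′
    cost-cong u≗u′ = sum-cong-≗ (λ i → cong (_*ℤ θ i) (u≗u′ i))
    form≡ : form x y ≡ form x′ y′
    form≡ = sum-cong-≗ (λ i → cong₂ _*ℤ_ (x≗x′ i) (sum-cong-≗ (λ j → cong (W i j *ℤ_) (y≗y′ j))))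

0≤d+d+k : ∀ {d k} {A : Set} → 0ℤ ≤ℤ d → 0ℤ ≤ℤ k × (A → 0ℤ <ℤ k) →
          0ℤ ≤ℤ d +ℤ d +ℤ k × (A → 0ℤ <ℤ d +ℤ d +ℤ k)
0≤d+d+k 0≤d (0≤k , 0<k) = +-mono-≤ 0≤d+d 0≤k , +-mono-≤-< 0≤d+d ∘ 0<k
  where 0≤d+d = +-mono-≤ 0≤d 0≤d

rise-offset : ∀ b c → let k = 1ℤ +ℤ ⟦ b ⟧ -ℤ + 2 *ℤ ⟦ b ∧ c ⟧ in 0ℤ ≤ℤ k × (true ≢ c → 0ℤ <ℤ k)
rise-offset false c     = +≤+ z≤n , λ _ → +<+ (s≤s z≤n)
rise-offset true  false = +≤+ z≤n , λ _ → +<+ (s≤s z≤n)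
rise-offset true  true  = +≤+ z≤n , λ t≢t → contradiction refl t≢t

fall-offset : ∀ b c → let k = 1ℤ -ℤ ⟦ b ⟧ +ℤ + 2 *ℤ ⟦ b ∧ c ⟧ in 0ℤ ≤ℤ k × (false ≢ c → 0ℤ <ℤ k)
fall-offset false c     = +≤+ z≤n , λ _ → +<+ (s≤s z≤n)
fall-offset true  false = +≤+ z≤n , λ f≢f → contradiction refl f≢f
fall-offset true  true  = +≤+ z≤n , λ _ → +<+ (s≤s z≤n)

rise-gain : ∀ B E S R → (1ℤ -ℤ 0ℤ) *ℤ (+ 2 *ℤ S -ℤ (+ 2 *ℤ R -ℤ B -ℤ 1ℤ)) ≡
                        (E +ℤ S -ℤ R) +ℤ (E +ℤ S -ℤ R) +ℤ (1ℤ +ℤ B -ℤ + 2 *ℤ E)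
rise-gain = solve-∀

fall-gain : ∀ B E S R → (0ℤ -ℤ 1ℤ) *ℤ (+ 2 *ℤ S -ℤ (+ 2 *ℤ R -ℤ B -ℤ 1ℤ)) ≡
                        (R -ℤ (1ℤ +ℤ (E +ℤ S))) +ℤ (R -ℤ (1ℤ +ℤ (E +ℤ S))) +ℤ (1ℤ -ℤ B +ℤ + 2 *ℤ E)
fall-gain = solve-∀

-- One vertex's share of the energy increase over two steps: y and y′ are its opinions at times
-- s and s + 2, b tells whether it is adjacent to v₁, c is the opinion of v₁ at time s + 1 and S
-- the number of its other +1 neighbours at time s + 1.
threshold-gain : ∀ (b c y : Bool) (S R : ℤ) {N} → N ≡ ⟦ b ∧ c ⟧ +ℤ S →
  let y′ = ⌊ R ≤ℤ? N ⌋
      g  = (⟦ y′ ⟧ -ℤ ⟦ y ⟧) *ℤ (+ 2 *ℤ S -ℤ (+ 2 *ℤ R -ℤ ⟦ b ⟧ -ℤ 1ℤ))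
  in 0ℤ ≤ℤ g × (y′ ≢ y → y′ ≢ c → 0ℤ <ℤ g)
threshold-gain b c y S R refl with R ≤ℤ? ⟦ b ∧ c ⟧ +ℤ S | y
... | yes _   | true  = ≤-refl , λ y′≢y _ → contradiction refl y′≢y
... | no  _   | false = ≤-refl , λ y′≢y _ → contradiction refl y′≢y
... | yes R≤N | false = map₂ const
  (subst (λ g → 0ℤ ≤ℤ g × (true ≢ c → 0ℤ <ℤ g)) (sym (rise-gain ⟦ b ⟧ ⟦ b ∧ c ⟧ S R))
    (0≤d+d+k (i≤j⇒0≤j-i R≤N) (rise-offset b c)))
... | no  R≰N | true  = map₂ const
  (subst (λ g → 0ℤ ≤ℤ g × (false ≢ c → 0ℤ <ℤ g)) (sym (fall-gain ⟦ b ⟧ ⟦ b ∧ c ⟧ S R))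
    (0≤d+d+k (i≤j⇒0≤j-i (i<j⇒suc[i]≤j (≰⇒> R≰N))) (fall-offset b c)))

module Network {n : ℕ} (G : Graph (suc n)) (r : Fin (suc n) → ℤ) where

  W : Fin n → Fin n → ℤ
  W i j = ⟦ adj G (suc i) (suc j) ⟧

  -- 2rᵢ − 1 rather than 2rᵢ breaks ties, and the further −1 for a neighbour of v₁ makes the
  -- network on v₂ … vₙ see v₁ as an input of weight ½.
  θ : Vector ℤ n
  θ i = + 2 *ℤ r (suc i) -ℤ ⟦ adj G (suc i) zero ⟧ -ℤ 1ℤ

  open Energy W (λ i j → cong ⟦_⟧ (Graph.sym G (suc i) (suc j))) θ

  others : State (suc n) → Vector ℤ n
  others u i = ⟦ u (suc i) ⟧

  nbrPlus-mono : ∀ {u u′} i → (∀ j → adj G i j ≡ true → u j ≡ true → u′ j ≡ true) →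
                 nbrPlus G u i ≤ nbrPlus G u′ i
  nbrPlus-mono i u⊆u′ = countTrue-mono λ j → ∧-keeps (adj G i j) (u⊆u′ j)

  nbrPlus-cong : ∀ {u u′} → u ≗ u′ → ∀ i → nbrPlus G u i ≡ nbrPlus G u′ i
  nbrPlus-cong u≗u′ i = ℕ.≤-antisym (nbrPlus-mono i (λ j _ → trans (sym (u≗u′ j))))
                                    (nbrPlus-mono i (λ j _ → trans (u≗u′ j)))

  step-cong : ∀ {u u′} → u ≗ u′ → step G r u ≗ step G r u′
  step-cong u≗u′ zero    = cong (λ N → ⌊ + N <ℤ? r zero ⌋) (nbrPlus-cong u≗u′ zero)
  step-cong u≗u′ (suc i) = cong (λ N → ⌊ r (suc i) ≤ℤ? + N ⌋) (nbrPlus-cong u≗u′ (suc i))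

  nbrPlus-suc : ∀ u i → + nbrPlus G u (suc i) ≡ ⟦ adj G (suc i) zero ∧ u zero ⟧ +ℤ input (others u) i
  nbrPlus-suc u i = trans (countTrue-∑ (λ j → adj G (suc i) j ∧ u j))
    (cong (⟦ adj G (suc i) zero ∧ u zero ⟧ +ℤ_) (sum-cong-≗ λ j → ⟦∧⟧ (adj G (suc i) (suc j)) (u (suc j))))

  gain : State (suc n) → Fin n → ℤ
  gain u i = (others (step G r (step G r u)) i -ℤ others u i) *ℤ localField (others (step G r u)) i

  gain-bounds : ∀ u i → let u₂ = step G r (step G r u) in
    0ℤ ≤ℤ gain u i × (u₂ (suc i) ≢ u (suc i) → u₂ (suc i) ≢ step G r u zero → 0ℤ <ℤ gain u i)
  gain-bounds u i = threshold-gain (adj G (suc i) zero) (step G r u zero) (u (suc i))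
    (input (others (step G r u)) i) (r (suc i)) (nbrPlus-suc (step G r u) i)

  threshold-keeps : ∀ x {u u′} l → (∀ j → u j ≡ x → u′ j ≡ x) →
                    step G r u (suc l) ≡ x → step G r u′ (suc l) ≡ x
  threshold-keeps true  l keep = ⌊⌋-mono (r (suc l) ≤ℤ? _) (r (suc l) ≤ℤ? _)
    (λ R≤N → ≤-trans R≤N (+≤+ (nbrPlus-mono (suc l) (λ j _ → keep j))))
  threshold-keeps false l keep = not-contrapositive true (⌊⌋-mono (r (suc l) ≤ℤ? _) (r (suc l) ≤ℤ? _)
    (λ R≤N → ≤-trans R≤N (+≤+ (nbrPlus-mono (suc l) (λ j _ → not-contrapositive false (keep j))))))

  anti-threshold-keeps : ∀ x {u u′} → (∀ j → adj G zero j ≡ true → u j ≡ x → u′ j ≡ x) →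
                         step G r u zero ≡ not x → step G r u′ zero ≡ not x
  anti-threshold-keeps true  keep = not-contrapositive true (⌊⌋-mono (_ <ℤ? r zero) (_ <ℤ? r zero)
    (≤-<-trans (+≤+ (nbrPlus-mono zero keep))))
  anti-threshold-keeps false keep = ⌊⌋-mono (_ <ℤ? r zero) (_ <ℤ? r zero)
    (≤-<-trans (+≤+ (nbrPlus-mono zero (λ j adj₀ⱼ → not-contrapositive false (keep j adj₀ⱼ)))))

  module Trajectory (s₀ : State (suc n)) (recurrent : Recurrent G r s₀) where

    private
      σ : ℕ → State (suc n)
      σ = run G r s₀

      p : ℕ
      p = proj₁ recurrent

    σ-periodic : ∀ s → σ (s + suc p) ≗ σ s
    σ-periodic zero    = proj₂ recurrent
    σ-periodic (suc s) = step-cong (σ-periodic s)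

    E : ℕ → ℤ
    E s = energy (others (σ (suc s))) (others (σ s))

    E-step : ∀ s → E (suc s) ≡ E s +ℤ ∑[ i < n ] gain (σ s) i
    E-step s = energy-step (others (σ s)) (others (σ (suc s))) (others (σ (suc (suc s))))

    E-constant : ∀ s → E (suc s) ≡ E s
    E-constant = nondecreasing-periodic⇒constant ≤-poset E p E-mono E-periodic
      where
      E-mono : ∀ s → E s ≤ℤ E (suc s)
      E-mono s = subst (E s ≤ℤ_) (sym (E-step s))
        (0≤j⇒i≤i+j (∑-nonneg (gain (σ s)) (λ i → proj₁ (gain-bounds (σ s) i))))
      E-periodic : ∀ s → E (s + suc p) ≡ E s
      E-periodic s = energy-cong (cong ⟦_⟧ ∘ σ-periodic (suc s) ∘ suc) (cong ⟦_⟧ ∘ σ-periodic s ∘ suc)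

    no-gain : ∀ s i → ¬ 0ℤ <ℤ gain (σ s) i
    no-gain s i 0<gain = <-irrefl refl (subst (E s <ℤ_) (trans (sym (E-step s)) (E-constant s))
      (0<j⇒i<i+j (∑-pos (gain (σ s)) (λ i → proj₁ (gain-bounds (σ s) i)) i 0<gain)))

    no-switch-against-input : ∀ {x} s i → σ (suc s) zero ≡ not x →
                              σ (suc (suc s)) (suc i) ≡ x → σ s (suc i) ≡ x
    no-switch-against-input {x} s i c₁ y₂ with σ s (suc i) ≟ x
    ... | yes y₀ = y₀
    ... | no  y₀≢x = contradiction (proj₂ (gain-bounds (σ s) i)
                       (λ y₂≡y₀ → y₀≢x (trans (sym y₂≡y₀) y₂))
                       (λ y₂≡c₁ → not-¬ refl (trans (sym y₂) (trans y₂≡c₁ c₁))))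
                     (no-gain s i)

    self-loop : ∀ x t → σ t zero ≡ x → σ (suc t) zero ≡ not x → σ (2 + t) zero ≡ x →
                σ (4 + t) zero ≡ not x → adj G zero zero ≡ true
    self-loop x t c₀ c₁ c₂ c₄ =
      ¬-not λ no-loop → not-¬ c₂ (anti-threshold-keeps x (back-from-3+t no-loop) c₄)
      where
      back-from-2+t : ∀ j → σ (2 + t) j ≡ x → σ t j ≡ x
      back-from-2+t zero    _ = c₀
      back-from-2+t (suc i)   = no-switch-against-input t i c₁
      back-from-3+t : adj G zero zero ≡ false →
                      ∀ j → adj G zero j ≡ true → σ (3 + t) j ≡ x → σ (1 + t) j ≡ x
      back-from-3+t no-loop zero    loop = contradiction (trans (sym no-loop) loop) λ ()
      back-from-3+t no-loop (suc l) _    = threshold-keeps x l back-from-2+t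

lemma5 : (n : ℕ) (G : Graph (suc n)) (r : Fin (suc n) → ℤ) (s₀ : State (suc n)) →
         Recurrent G r s₀ →
         (x : Bool) (t : ℕ) →
         c G r s₀ t ≡ x → c G r s₀ (t + 1) ≡ not x → c G r s₀ (t + 2) ≡ x →
         c G r s₀ (t + 3) ≡ x → c G r s₀ (t + 4) ≡ not x →
         adj G zero zero ≡ true
lemma5 n G r s₀ recurrent x t c₀ c₁ c₂ _ c₄ =
  Network.Trajectory.self-loop G r s₀ recurrent x t c₀ (shift 1 c₁) (shift 2 c₂) (shift 4 c₄)
  where
  shift : ∀ k {y} → c G r s₀ (t + k) ≡ y → c G r s₀ (k + t) ≡ y
  shift k {y} = subst (λ m → c G r s₀ m ≡ y) (ℕ.+-comm t k)
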